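{- Let $\mathcal L$ be a uniform semimodular lattice. The parallel relation $\approx$ is an equivalence relation on the set of all rays of $\mathcal L$.
   Context: Lattices satisfy (F): no interval contains a chain of infinite length. $x\prec_1y$: $y$ covers $x$. Semimodular: $x\wedge a\prec_1a$ implies $x\prec_1x\vee a$. Ascending operator $(x)^+:=\bigvee\{y: y\text{ covers }x\}$; uniform semimodular lattice: semimodular lattice where $(x)^+$ always exists and $(\cdot)^+$ is an automorphism. Segment: chain $e^0\prec\cdots\prec e^s$ with $e^{\ell-1}\prec_1e^\ell$ and $e^{\ell+1}\notin[e^{\ell-1},(e^{\ell-1})^+]$ for $1\le\ell\le s-1$; ray: infinite chain $e^0\prec e^1\prec\cdots$ all of whose initial pieces are segments; $x$-ray: ray with $e^0=x$. For an $x$-ray $(e^\ell)$ and $y\succeq x$ there is an index $\ell$ with $e^\ell\preceq y$ and $e^{\ell+1}\not\preceq y$, and $(e^\ell)\vee y$ denotes the $y$-ray $y=e^\ell\vee y\prec e^{\ell+1}\vee y\prec\cdots$. An $x$-ray $(e^\ell)$ and a $y$-ray $(f^\ell)$ are parallel, $(e^\ell)\approx(f^\ell)$, if $(e^\ell)\vee(x\vee y)=(f^\ell)\vee(x\vee y)$. -}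

module Defs where

open import Level using (Level; _⊔_)
open import Data.Nat using (ℕ; zero; suc; _+_) renaming (_≤_ to _≤ℕ_)
open import Data.Product using (Σ; ∃; ∃-syntax; _×_; _,_)
open import Data.Sum using (_⊎_)
open import Relation.Nullary using (¬_)
open import Relation.Binary.PropositionalEquality using (_≡_)
open import Relation.Binary.Lattice.Bundles using (Lattice)

module LatticeNotions {c ℓ₁ ℓ₂ : Level} (L : Lattice c ℓ₁ ℓ₂) where
  open Lattice L

  _<_ : Carrier → Carrier → Set (ℓ₁ ⊔ ℓ₂)
  x < y = (x ≤ y) × ¬ (x ≈ y)

  _≺₁_ : Carrier → Carrier → Set (c ⊔ ℓ₁ ⊔ ℓ₂)
  x ≺₁ y = (x < y) × (∀ z → x < z → ¬ (z < y))

  -- condition (F): no interval [a,b] contains a chain of infinite length,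
  -- i.e. there is no injective sequence of pairwise comparable elements of [a,b].
  ConditionF : Set (c ⊔ ℓ₁ ⊔ ℓ₂)
  ConditionF = ∀ a b → ¬ (Σ (ℕ → Carrier) λ f →
                 (∀ i → (a ≤ f i) × (f i ≤ b))
               × (∀ i j → f i ≈ f j → i ≡ j)
               × (∀ i j → (f i ≤ f j) ⊎ (f j ≤ f i)))

  Semimodular : Set (c ⊔ ℓ₁ ⊔ ℓ₂)
  Semimodular = ∀ x a → (x ∧ a) ≺₁ a → x ≺₁ (x ∨ a)

  IsJoinOfCovers : Carrier → Carrier → Set (c ⊔ ℓ₁ ⊔ ℓ₂)
  IsJoinOfCovers x u = (∀ y → x ≺₁ y → y ≤ u)
                     × (∀ v → (∀ y → x ≺₁ y → y ≤ v) → u ≤ v)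

  record IsAutomorphism (φ : Carrier → Carrier) : Set (c ⊔ ℓ₁ ⊔ ℓ₂) where
    field
      cong       : ∀ {x y} → x ≈ y → φ x ≈ φ y
      ∨-homo     : ∀ x y → φ (x ∨ y) ≈ φ x ∨ φ y
      ∧-homo     : ∀ x y → φ (x ∧ y) ≈ φ x ∧ φ y
      injective  : ∀ {x y} → φ x ≈ φ y → x ≈ y
      surjective : ∀ y → ∃[ x ] (φ x ≈ y)

  -- uniform semimodular lattice (satisfying the standing assumption (F));
  -- ⁺ is the ascending operator (x)^+ = ⋁ {y : y covers x}
  record IsUniformSemimodular : Set (c ⊔ ℓ₁ ⊔ ℓ₂) where
    field
      conditionF     : ConditionF
      semimodular    : Semimodular
      _⁺             : Carrier → Carrier
      ⁺-isJoin       : ∀ x → IsJoinOfCovers x (x ⁺)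
      ⁺-automorphism : IsAutomorphism _⁺

module RayNotions {c ℓ₁ ℓ₂ : Level} (L : Lattice c ℓ₁ ℓ₂)
                  (U : LatticeNotions.IsUniformSemimodular L) where
  open Lattice L
  open LatticeNotions L
  open IsUniformSemimodular U

  IsSegment : ℕ → (ℕ → Carrier) → Set (c ⊔ ℓ₁ ⊔ ℓ₂)
  IsSegment s e = (∀ i → suc i ≤ℕ s → e i ≺₁ e (suc i))
                × (∀ i → suc (suc i) ≤ℕ s →
                     ¬ ((e i ≤ e (suc (suc i))) × (e (suc (suc i)) ≤ (e i) ⁺)))

  IsRay : (ℕ → Carrier) → Set (c ⊔ ℓ₁ ⊔ ℓ₂)
  IsRay e = ∀ s → IsSegment s e

  Ray : Set (c ⊔ ℓ₁ ⊔ ℓ₂)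
  Ray = Σ (ℕ → Carrier) IsRay

  IsJoinIndex : (ℕ → Carrier) → Carrier → ℕ → Set ℓ₂
  IsJoinIndex e y ℓ = (e ℓ ≤ y) × ¬ (e (suc ℓ) ≤ y)

  IsJoinRay : (ℕ → Carrier) → Carrier → (ℕ → Carrier) → Set (ℓ₁ ⊔ ℓ₂)
  IsJoinRay e y g = ∃[ ℓ ] (IsJoinIndex e y ℓ × (∀ m → g m ≈ (e (ℓ + m) ∨ y)))

  _∥_ : Ray → Ray → Set (c ⊔ ℓ₁ ⊔ ℓ₂)
  (e , _) ∥ (f , _) =
    ∃[ g ] (IsJoinRay e (e 0 ∨ f 0) g × IsJoinRay f (e 0 ∨ f 0) g)

module Submission where

-- For an x-ray e and y ≥ x write (e) ∨ y for the y-ray obtained by joining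
-- the tail of e with y.  Two rays e, h have a common join at u if
-- (e) ∨ u = (h) ∨ u; parallelism is a common join at e 0 ∨ h 0.
-- Reflexivity and symmetry are immediate.  For transitivity, a common join
-- at u persists to every v ≥ u (associativity ((e) ∨ u) ∨ v = (e) ∨ v), so
-- e ∥ f and f ∥ h give a common join of e and h at a large u; it then
-- descends to e 0 ∨ h 0 because joining is injective:
--   x-rays g, k with (g) ∨ z = (k) ∨ z coincide (for x ≤ z).
-- Injectivity, and the fact that (g) ∨ z is a ray at all, are proved by
-- upward induction on the interval [x, z] (available by condition (F)),
-- the induction step being the case of a cover x ≺₁ d, where semimodularity
-- and straightness of rays are used.

open import Defs
open import Level using (_⊔_; Lift; lift; lower)
open import Axiom.ExcludedMiddle using (ExcludedMiddle)
open import Relation.Binary.Core using (Rel)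
open import Relation.Binary.Definitions using (Transitive; Decidable; tri<; tri≈; tri>)
open import Relation.Binary.Structures using (IsEquivalence)
open import Relation.Binary.Lattice.Bundles using (Lattice)
import Relation.Binary.Properties.Poset as PosetProperties
import Relation.Binary.Lattice.Properties.JoinSemilattice as JoinProperties
import Relation.Binary.Reasoning.PartialOrder as ≤-Reasoning
open import Data.Nat using (ℕ; zero; suc; z≤n; s≤s) renaming (_≤_ to _≤ℕ_; _<_ to _<ℕ_; _+_ to _+ℕ_)
import Data.Nat.Properties as ℕP
open import Data.Nat.GeneralisedArithmetic using (fold)
open import Data.Product using (Σ; ∃; _×_; _,_; proj₁; proj₂)
open import Data.Sum using (_⊎_; inj₁; inj₂; swap)
open import Data.Empty using (⊥; ⊥-elim)
open import Function using (_∘_; flip)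
open import Relation.Nullary using (¬_; yes; no)
import Relation.Binary.PropositionalEquality as P

related-later : ∀ {a r} {A : Set a} {R : Rel A r} → Transitive R →
                (f : ℕ → A) → (∀ i → R (f i) (f (suc i))) →
                ∀ {i j} → i <ℕ j → R (f i) (f j)
related-later {R = R} R-trans f step {i} {suc j} (s≤s i≤j) with ℕP.m≤n⇒m<n∨m≡n i≤j
... | inj₁ i<j    = R-trans {f i} {f j} (related-later {R = R} R-trans f step i<j) (step j)
... | inj₂ P.refl = step i

module Basics {c ℓ₁ ℓ₂} (L : Lattice c ℓ₁ ℓ₂) where
  open Lattice L
  open LatticeNotions L
  open PosetProperties poset public using (<-trans; <-respˡ-≈; <-respʳ-≈; <⇒≱)
  open JoinProperties joinSemilattice public
    using (∨-monotonic; ∨-cong; ∨-comm; ∨-idempotent)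

  private variable x x′ y y′ a b : Carrier

  Seq : Set c
  Seq = ℕ → Carrier

  _≋_ : Seq → Seq → Set ℓ₁
  f ≋ g = ∀ m → f m ≈ g m

  shift : Seq → Seq
  shift f m = f (suc m)

  Ascending : Seq → Set ℓ₂
  Ascending f = ∀ i → f i ≤ f (suc i)

  ascending : ∀ {f} → Ascending f → ∀ {i j} → i ≤ℕ j → f i ≤ f j
  ascending {f} step i≤j with ℕP.m≤n⇒m<n∨m≡n i≤j
  ... | inj₁ i<j    = related-later {R = _≤_} trans f step i<j
  ... | inj₂ P.refl = refl

  ≈⇒≥ : x ≈ y → y ≤ x
  ≈⇒≥ = reflexive ∘ Eq.sym

  ≺₁⇒≤ : x ≺₁ y → x ≤ y
  ≺₁⇒≤ = proj₁ ∘ proj₁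

  ≺₁⇒≱ : x ≺₁ y → ¬ y ≤ x
  ≺₁⇒≱ = <⇒≱ ∘ proj₁

  ≺₁-resp-≈ : x ≈ x′ → y ≈ y′ → x ≺₁ y → x′ ≺₁ y′
  ≺₁-resp-≈ x≈x′ y≈y′ (x<y , nothing-between) =
    <-respˡ-≈ x≈x′ (<-respʳ-≈ y≈y′ x<y) ,
    λ z x′<z z<y′ → nothing-between z (<-respˡ-≈ (Eq.sym x≈x′) x′<z)
                                      (<-respʳ-≈ (Eq.sym y≈y′) z<y′)

  ∨-absorbs-below : y ≤ x → x ∨ y ≈ x
  ∨-absorbs-below y≤x = antisym (∨-least refl y≤x) (x≤x∨y _ _)

  ∨-absorb : a ≤ b → b ∨ y ≈ b ∨ (a ∨ y)
  ∨-absorb a≤b = antisym (∨-monotonic refl (y≤x∨y _ _))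
                         (∨-least (x≤x∨y _ _) (∨-least (trans a≤b (x≤x∨y _ _)) (y≤x∨y _ _)))

  ∨-absorb-under : a ≤ b → x ∨ b ≈ (x ∨ a) ∨ b
  ∨-absorb-under a≤b = antisym (∨-monotonic (x≤x∨y _ _) refl)
                               (∨-least (∨-least (x≤x∨y _ _) (trans a≤b (y≤x∨y _ _))) (y≤x∨y _ _))

  module AutomorphismFacts {φ : Carrier → Carrier} (φ-auto : IsAutomorphism φ) where
    open IsAutomorphism φ-auto

    φ-mono : x ≤ y → φ x ≤ φ y
    φ-mono {x} {y} x≤y = begin
      φ x         ≤⟨ x≤x∨y _ _ ⟩
      φ x ∨ φ y   ≈⟨ Eq.sym (∨-homo x y) ⟩
      φ (x ∨ y)   ≈⟨ cong (antisym (∨-least x≤y refl) (y≤x∨y x y)) ⟩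
      φ y         ∎
      where open ≤-Reasoning poset

    φ-∧ : φ x ∧ φ y ≤ φ (x ∧ y)
    φ-∧ = ≈⇒≥ (∧-homo _ _)

module Classical {c ℓ₁ ℓ₂} (em : ExcludedMiddle (c ⊔ ℓ₁ ⊔ ℓ₂)) (L : Lattice c ℓ₁ ℓ₂) where
  open Lattice L
  open LatticeNotions L
  open Basics L

  private variable x y d : Carrier

  stable : {Q : Set (c ⊔ ℓ₁ ⊔ ℓ₂)} → ¬ ¬ Q → Q
  stable {Q} ¬¬q with em {Q}
  ... | yes q  = q
  ... | no  ¬q = ⊥-elim (¬¬q ¬q)

  _≤?_ : Decidable _≤_
  x ≤? y with em {Lift (c ⊔ ℓ₁) (x ≤ y)}
  ... | yes (lift x≤y) = yes x≤y
  ... | no  x≰y        = no (x≰y ∘ lift)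

  cover-dichotomy : x ≺₁ d → x ≤ y → y ≤ d → y ≤ x ⊎ d ≤ y
  cover-dichotomy {x} {d} {y} (_ , nothing-between) x≤y y≤d with y ≤? x | d ≤? y
  ... | yes y≤x | _       = inj₁ y≤x
  ... | no _    | yes d≤y = inj₂ d≤y
  ... | no y≰x  | no d≰y  =
    ⊥-elim (nothing-between y (x≤y , y≰x ∘ ≈⇒≥) (y≤d , d≰y ∘ ≈⇒≥))

  cover-squeeze : x ≺₁ d → x ≤ y → y ≤ d → ¬ y ≤ x → y ≈ d
  cover-squeeze x≺d x≤y y≤d y≰x with cover-dichotomy x≺d x≤y y≤d
  ... | inj₁ y≤x = ⊥-elim (y≰x y≤x)
  ... | inj₂ d≤y = antisym y≤d d≤y

  cover-meet : x ≺₁ d → x ≤ y → ¬ d ≤ y → y ∧ d ≈ x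
  cover-meet x≺d x≤y d≰y with cover-dichotomy x≺d (∧-greatest x≤y (≺₁⇒≤ x≺d)) (x∧y≤y _ _)
  ... | inj₁ y∧d≤x = antisym y∧d≤x (∧-greatest x≤y (≺₁⇒≤ x≺d))
  ... | inj₂ d≤y∧d = ⊥-elim (d≰y (trans d≤y∧d (x∧y≤x _ _)))

  cover-transfer : Semimodular → x ≺₁ d → x ≤ y → ¬ d ≤ y → y ≺₁ (y ∨ d)
  cover-transfer semimodular x≺d x≤y d≰y =
    semimodular _ _ (≺₁-resp-≈ (Eq.sym (cover-meet x≺d x≤y d≰y)) Eq.refl x≺d)

module FiniteLength {c ℓ₁ ℓ₂} (em : ExcludedMiddle (c ⊔ ℓ₁ ⊔ ℓ₂)) (L : Lattice c ℓ₁ ℓ₂)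
                    (conditionF : LatticeNotions.ConditionF L) where
  open Lattice L
  open LatticeNotions L
  open Basics L
  open Classical em L

  private variable y : Carrier

  -- Walks in both directions are treated at once: R is a transitive
  -- relation between comparable, unequal elements (here < or >).
  module StrictWalks {r} (R : Rel Carrier r) (R-trans : Transitive R)
                     (R-comparable : ∀ {x y} → R x y → x ≤ y ⊎ y ≤ x)
                     (R-≉ : ∀ {x y} → R x y → ¬ x ≈ y) where

    no-strict-chain : ∀ a b (f : Seq) → (∀ i → a ≤ f i × f i ≤ b) →
                      ¬ (∀ i → R (f i) (f (suc i)))
    no-strict-chain a b f bounded step = conditionF a b (f , bounded , injective , comparable)
      where
      later : ∀ {i j} → i <ℕ j → R (f i) (f j)
      later = related-later {R = R} R-trans f step

      injective : ∀ i j → f i ≈ f j → i P.≡ j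
      injective i j fi≈fj with ℕP.<-cmp i j
      ... | tri< i<j _ _ = ⊥-elim (R-≉ (later i<j) fi≈fj)
      ... | tri≈ _ i≡j _ = i≡j
      ... | tri> _ _ j<i = ⊥-elim (R-≉ (later j<i) (Eq.sym fi≈fj))

      comparable : ∀ i j → f i ≤ f j ⊎ f j ≤ f i
      comparable i j with ℕP.<-cmp i j
      ... | tri< i<j _ _    = R-comparable (later i<j)
      ... | tri≈ _ P.refl _ = inj₁ refl
      ... | tri> _ _ j<i    = swap (R-comparable (later j<i))

    no-endless-walk : ∀ {p} a b (Pr : Carrier → Set p) →
                      (∀ {y} → Pr y → a ≤ y × y ≤ b) →
                      (∀ {y} → Pr y → Σ Carrier λ y′ → Pr y′ × R y y′) →
                      ∀ {y} → ¬ Pr y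
    no-endless-walk a b Pr bounded next {y} py =
      no-strict-chain a b (proj₁ ∘ walk) (λ i → bounded (proj₂ (walk i)))
                      (λ i → proj₂ (proj₂ (next (proj₂ (walk i)))))
      where
      advance : Σ Carrier Pr → Σ Carrier Pr
      advance w = proj₁ (next (proj₂ w)) , proj₁ (proj₂ (next (proj₂ w)))

      walk : ℕ → Σ Carrier Pr
      walk = fold (y , py) advance

  open StrictWalks _<_ <-trans (inj₁ ∘ proj₁) proj₂
    renaming (no-strict-chain to no-strict-ascent; no-endless-walk to no-endless-ascent)
  open StrictWalks (flip _<_) (λ y<x z<y → <-trans z<y y<x) (inj₂ ∘ proj₁)
                   (λ y<x x≈y → proj₂ y<x (Eq.sym x≈y))
    using () renaming (no-endless-walk to no-endless-descent)

  up-induction : ∀ z (Q : Carrier → Set (c ⊔ ℓ₁ ⊔ ℓ₂)) →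
                 (∀ {x} → x ≤ z → (∀ {d} → x < d → d ≤ z → Q d) → Q x) →
                 ∀ {x} → x ≤ z → Q x
  up-induction z Q step {x} x≤z =
    stable λ ¬Qx → no-endless-ascent x z Counterexample bounds next (refl , x≤z , ¬Qx)
    where
    Counterexample : Carrier → Set (c ⊔ ℓ₁ ⊔ ℓ₂)
    Counterexample y = x ≤ y × y ≤ z × ¬ Q y

    bounds : ∀ {y} → Counterexample y → x ≤ y × y ≤ z
    bounds (x≤y , y≤z , _) = x≤y , y≤z

    next : ∀ {y} → Counterexample y → Σ Carrier λ d → Counterexample d × y < d
    next (x≤y , y≤z , ¬Qy) = stable λ none → ¬Qy (step y≤z λ y<d d≤z →
      stable λ ¬Qd → none (_ , (trans x≤y (proj₁ y<d) , d≤z , ¬Qd) , y<d))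

  cover-below : ∀ {x z} → x < z → Σ Carrier λ d → x ≺₁ d × d ≤ z
  cover-below {x} {z} x<z = stable λ none →
    no-endless-descent x z Above (λ (x<y , y≤z) → proj₁ x<y , y≤z) (next none) (x<z , refl)
    where
    Above : Carrier → Set (ℓ₁ ⊔ ℓ₂)
    Above y = x < y × y ≤ z

    next : ¬ (Σ Carrier λ d → x ≺₁ d × d ≤ z) →
           ∀ {y} → Above y → Σ Carrier λ w → Above w × w < y
    next none {y} (x<y , y≤z) = stable λ stuck →
      none (y , (x<y , λ w x<w w<y → stuck (w , (x<w , trans (proj₁ w<y) y≤z) , w<y)) , y≤z)

  exit-index : (f : Seq) → (∀ i → f i < f (suc i)) → f 0 ≤ y →
               ∃ λ ℓ → f ℓ ≤ y × ¬ f (suc ℓ) ≤ y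
  exit-index {y} f step f0≤y = lower {ℓ = c ⊔ ℓ₁} (stable λ no-exit →
    no-strict-ascent (f 0) y f
      (λ i → ascending (proj₁ ∘ step) z≤n , below (no-exit ∘ lift) i) step)
    where
    below : ¬ (∃ λ ℓ → f ℓ ≤ y × ¬ f (suc ℓ) ≤ y) → ∀ i → f i ≤ y
    below _ zero = f0≤y
    below no-exit (suc i) with f (suc i) ≤? y
    ... | yes fi′≤y = fi′≤y
    ... | no  fi′≰y = ⊥-elim (no-exit (i , below no-exit i , fi′≰y))

module Rays {c ℓ₁ ℓ₂} (em : ExcludedMiddle (c ⊔ ℓ₁ ⊔ ℓ₂)) (L : Lattice c ℓ₁ ℓ₂)
            (U : LatticeNotions.IsUniformSemimodular L) where
  open Lattice L
  open LatticeNotions L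
  open IsUniformSemimodular U
  open IsAutomorphism ⁺-automorphism using () renaming (cong to ⁺-cong)
  open RayNotions L U
  open Basics L
  open AutomorphismFacts ⁺-automorphism renaming (φ-mono to ⁺-mono; φ-∧ to ⁺-∧)
  open Classical em L
  open FiniteLength em L conditionF
  open ≤-Reasoning poset

  private variable
    x y y′ z u v d : Carrier
    a b : ℕ
    e e′ f g h k G H W W′ : Seq

  ≺₁⇒≤⁺ : x ≺₁ y → y ≤ x ⁺
  ≺₁⇒≤⁺ {x} {y} = proj₁ (⁺-isJoin x) y

  ray-cover : IsRay e → ∀ i → e i ≺₁ e (suc i)
  ray-cover r i = proj₁ (r (suc i)) i ℕP.≤-refl

  ray-straight : IsRay e → ∀ i → ¬ e (suc (suc i)) ≤ e i ⁺
  ray-straight r i above = proj₂ (r (suc (suc i))) i ℕP.≤-refl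
    (trans (≺₁⇒≤ (ray-cover r i)) (≺₁⇒≤ (ray-cover r (suc i))) , above)

  ray-intro : (∀ i → e i ≺₁ e (suc i)) → (∀ i → ¬ e (suc (suc i)) ≤ e i ⁺) → IsRay e
  ray-intro covers straight s = (λ i _ → covers i) , (λ i _ between → straight i (proj₂ between))

  ray-ascending : IsRay e → Ascending e
  ray-ascending r = ≺₁⇒≤ ∘ ray-cover r

  ray-base : IsRay e → ∀ m → e 0 ≤ e m
  ray-base r m = ascending (ray-ascending r) z≤n

  ray-shift : IsRay e → IsRay (shift e)
  ray-shift r = ray-intro (ray-cover r ∘ suc) (ray-straight r ∘ suc)

  ray-resp : IsRay e → e ≋ e′ → IsRay e′
  ray-resp {e} {e′} r e≋e′ = ray-intro
    (λ i → ≺₁-resp-≈ (e≋e′ i) (e≋e′ (suc i)) (ray-cover r i))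
    (λ i above → ray-straight r i (begin
      e (suc (suc i))   ≈⟨ e≋e′ (suc (suc i)) ⟩
      e′ (suc (suc i))  ≤⟨ above ⟩
      e′ i ⁺            ≈⟨ ⁺-cong (Eq.sym (e≋e′ i)) ⟩
      e i ⁺             ∎))

  below-base⁺ : IsRay e → ∀ j {t} → t ≤ e (suc j) → t ≤ e 0 ⁺ → t ≤ e 1
  below-base⁺ r zero t≤e1 _ = t≤e1
  below-base⁺ {e} r (suc j) {t} t≤next t≤e0⁺ with t ≤? e (suc j)
  ... | yes t≤cur = below-base⁺ r j t≤cur t≤e0⁺
  ... | no  t≰cur with cover-dichotomy (ray-cover r (suc j)) (y≤x∨y t _)
                         (∨-least t≤next (≺₁⇒≤ (ray-cover r (suc j))))
  ...   | inj₁ t∨cur≤cur  = ⊥-elim (t≰cur (trans (x≤x∨y _ _) t∨cur≤cur))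
  ...   | inj₂ next≤t∨cur = ⊥-elim (ray-straight r j (begin
            e (suc (suc j))  ≤⟨ next≤t∨cur ⟩
            t ∨ e (suc j)    ≤⟨ ∨-least (trans t≤e0⁺ (⁺-mono (ray-base r j)))
                                        (≺₁⇒≤⁺ (ray-cover r j)) ⟩
            e j ⁺            ∎))

  join-ray-ascending : Ascending e → IsJoinRay e y W → Ascending W
  join-ray-ascending {e} {y} {W} asc (ℓ , _ , W≈) m = begin
    W m                    ≈⟨ W≈ m ⟩
    e (ℓ +ℕ m) ∨ y         ≤⟨ ∨-monotonic (ascending asc (ℕP.+-monoʳ-≤ ℓ (ℕP.n≤1+n m))) refl ⟩
    e (ℓ +ℕ suc m) ∨ y     ≈⟨ Eq.sym (W≈ (suc m)) ⟩
    W (suc m)              ∎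

  join-ray-base : IsJoinRay e y W → W 0 ≈ y
  join-ray-base {e} {y} {W} (ℓ , (eℓ≤y , _) , W≈) = begin-equality
    W 0            ≈⟨ W≈ 0 ⟩
    e (ℓ +ℕ 0) ∨ y ≈⟨ ∨-comm _ _ ⟩
    y ∨ e (ℓ +ℕ 0) ≈⟨ ∨-absorbs-below (P.subst (λ n → e n ≤ y) (P.sym (ℕP.+-identityʳ ℓ)) eℓ≤y) ⟩
    y              ∎

  join-ray-base≤ : Ascending e → IsJoinRay e y W → e 0 ≤ y
  join-ray-base≤ asc (ℓ , (eℓ≤y , _) , _) = trans (ascending asc z≤n) eℓ≤y

  join-index-unique : Ascending e → IsJoinIndex e y a → IsJoinIndex e y b → a P.≡ b
  join-index-unique {a = a} {b = b} asc (ea≤y , ea′≰y) (eb≤y , eb′≰y) with ℕP.<-cmp a b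
  ... | tri< a<b _ _ = ⊥-elim (ea′≰y (trans (ascending asc a<b) eb≤y))
  ... | tri≈ _ a≡b _ = a≡b
  ... | tri> _ _ b<a = ⊥-elim (eb′≰y (trans (ascending asc b<a) ea≤y))

  join-ray-unique : Ascending e → IsJoinRay e y W → IsJoinRay e y W′ → W ≋ W′
  join-ray-unique asc (a , ia , W≈) (b , ib , W′≈) m with join-index-unique asc ia ib
  ... | P.refl = Eq.trans (W≈ m) (Eq.sym (W′≈ m))

  join-ray-resp : IsJoinRay e y W → W ≋ W′ → IsJoinRay e y W′
  join-ray-resp (ℓ , iℓ , W≈) W≋W′ = ℓ , iℓ , λ m → Eq.trans (Eq.sym (W≋W′ m)) (W≈ m)

  join-ray-resp-base : IsJoinRay e y W → y ≈ y′ → IsJoinRay e y′ W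
  join-ray-resp-base (ℓ , (eℓ≤y , eℓ′≰y) , W≈) y≈y′ =
    ℓ , (trans eℓ≤y (reflexive y≈y′) , λ eℓ′≤y′ → eℓ′≰y (trans eℓ′≤y′ (≈⇒≥ y≈y′))) ,
    λ m → Eq.trans (W≈ m) (∨-cong Eq.refl y≈y′)

  join-ray-exists : IsRay e → e 0 ≤ y → ∃ (IsJoinRay e y)
  join-ray-exists {e} {y} r e0≤y with exit-index e (proj₁ ∘ ray-cover r) e0≤y
  ... | ℓ , exit = (λ m → e (ℓ +ℕ m) ∨ y) , ℓ , exit , λ _ → Eq.refl

  join-ray-self : IsRay e → e 0 ≈ y → IsJoinRay e y e
  join-ray-self r e0≈y =
    0 , (reflexive e0≈y , λ e1≤y → ≺₁⇒≱ (ray-cover r 0) (trans e1≤y (≈⇒≥ e0≈y))) ,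
    λ m → Eq.sym (∨-absorbs-below (trans (≈⇒≥ e0≈y) (ray-base r m)))

  join-index-order : Ascending e → IsJoinIndex e y a → y ≤ u → IsJoinIndex e u b → a ≤ℕ b
  join-index-order asc (ea≤y , _) y≤u (_ , eb′≰u) =
    ℕP.≮⇒≥ λ b<a → eb′≰u (trans (ascending asc b<a) (trans ea≤y y≤u))

  join-ray-assoc : Ascending e → IsJoinRay e y G → y ≤ u → IsJoinRay e u W → IsJoinRay G u W
  join-ray-assoc {e} {y} {G} {u} {W} asc (a , ia , G≈) y≤u (b , ib , W≈)
    with ℕP.m≤n⇒∃[o]m+o≡n (join-index-order asc ia y≤u ib)
  ... | δ , P.refl = δ , (Gδ≤u , Gδ′≰u) , W≈G∨u
    where
    regroup : ∀ m → e (a +ℕ (δ +ℕ m)) ≈ e ((a +ℕ δ) +ℕ m)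
    regroup m = Eq.reflexive (P.cong e (P.sym (ℕP.+-assoc a δ m)))

    Gδ≤u : G δ ≤ u
    Gδ≤u = trans (reflexive (G≈ δ)) (∨-least (proj₁ ib) y≤u)

    Gδ′≰u : ¬ G (suc δ) ≤ u
    Gδ′≰u Gδ′≤u = proj₂ ib (begin
      e (suc (a +ℕ δ))  ≈⟨ Eq.reflexive (P.cong e (P.sym (ℕP.+-suc a δ))) ⟩
      e (a +ℕ suc δ)    ≤⟨ x≤x∨y _ _ ⟩
      e (a +ℕ suc δ) ∨ y ≈⟨ Eq.sym (G≈ (suc δ)) ⟩
      G (suc δ)         ≤⟨ Gδ′≤u ⟩
      u                 ∎)

    W≈G∨u : ∀ m → W m ≈ G (δ +ℕ m) ∨ u
    W≈G∨u m = begin-equality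
      W m                              ≈⟨ W≈ m ⟩
      e ((a +ℕ δ) +ℕ m) ∨ u            ≈⟨ ∨-cong (Eq.sym (regroup m)) Eq.refl ⟩
      e (a +ℕ (δ +ℕ m)) ∨ u            ≈⟨ ∨-absorb-under y≤u ⟩
      (e (a +ℕ (δ +ℕ m)) ∨ y) ∨ u      ≈⟨ ∨-cong (Eq.sym (G≈ (δ +ℕ m))) Eq.refl ⟩
      G (δ +ℕ m) ∨ u                   ∎

  -- Either g climbs to d
  -- (g 1 = d) and (g) ∨ d is g without its first term, or g never passes
  -- above d and (g) ∨ d is the pointwise join g m ∨ d, again a ray.
  module CoverStep {g : Seq} (ray : IsRay g) {x d : Carrier} (g0≈x : g 0 ≈ x) (x≺d : x ≺₁ d) where

    x≤g : ∀ m → x ≤ g m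
    x≤g m = trans (≈⇒≥ g0≈x) (ray-base ray m)

    g0≤d : g 0 ≤ d
    g0≤d = trans (reflexive g0≈x) (≺₁⇒≤ x≺d)

    d≤g0⁺ : d ≤ g 0 ⁺
    d≤g0⁺ = trans (≺₁⇒≤⁺ x≺d) (⁺-mono (≈⇒≥ g0≈x))

    climbs : g 1 ≤ d → g 1 ≈ d
    climbs g1≤d = cover-squeeze x≺d (x≤g 1) g1≤d
                    (λ g1≤x → ≺₁⇒≱ (ray-cover ray 0) (trans g1≤x (≈⇒≥ g0≈x)))

    reaches⇒climbs : d ≤ g 1 → g 1 ≤ d
    reaches⇒climbs d≤g1 = ≈⇒≥ (cover-squeeze (ray-cover ray 0) g0≤d d≤g1
                                (λ d≤g0 → ≺₁⇒≱ x≺d (trans d≤g0 (reflexive g0≈x))))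

    -- by straightness, a ray that does not climb to d never passes above d
    never-above : ¬ g 1 ≤ d → ∀ m → ¬ d ≤ g m
    never-above _    zero    d≤g0 = ≺₁⇒≱ x≺d (trans d≤g0 (reflexive g0≈x))
    never-above g1≰d (suc j) d≤g  = g1≰d (reaches⇒climbs (below-base⁺ ray j d≤g d≤g0⁺))

    climbing-join : g 1 ≤ d → IsJoinRay g d (shift g)
    climbing-join g1≤d = 1 , (g1≤d , g2≰d) ,
      λ m → Eq.sym (∨-absorbs-below (trans (≈⇒≥ (climbs g1≤d)) (ascending (ray-ascending ray) (s≤s z≤n))))
      where
      g2≰d : ¬ g 2 ≤ d
      g2≰d g2≤d = ray-straight ray 0 (trans g2≤d d≤g0⁺)

    lifted : Seq
    lifted m = g m ∨ d

    lifting-join : ¬ g 1 ≤ d → IsJoinRay g d lifted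
    lifting-join g1≰d = 0 , (g0≤d , g1≰d) , λ _ → Eq.refl

    -- semimodularity lifts every cover g m ≺₁ g (m+1) to the joins with d,
    -- and the automorphism ⁺ carries straightness along
    lifted-ray : ¬ g 1 ≤ d → IsRay lifted
    lifted-ray g1≰d = ray-intro step-cover step-straight
      where
      d-cover : ∀ m → g m ≺₁ lifted m
      d-cover m = cover-transfer semimodular x≺d (x≤g m) (never-above g1≰d m)

      next-not-below : ∀ m → ¬ g (suc m) ≤ lifted m
      next-not-below m g′≤ with cover-dichotomy (d-cover m) (ray-ascending ray m) g′≤
      ... | inj₁ g′≤g      = ≺₁⇒≱ (ray-cover ray m) g′≤g
      ... | inj₂ lifted≤g′ = never-above g1≰d (suc m) (trans (y≤x∨y _ _) lifted≤g′)

      meets : ∀ m → lifted m ∧ g (suc m) ≈ g m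
      meets m = cover-meet (ray-cover ray m) (x≤x∨y _ _) (next-not-below m)

      regroup : ∀ m → lifted m ∨ g (suc m) ≈ lifted (suc m)
      regroup m = antisym
        (∨-least (∨-monotonic (ray-ascending ray m) refl) (x≤x∨y _ _))
        (∨-least (y≤x∨y _ _) (trans (y≤x∨y _ _) (x≤x∨y _ _)))

      step-cover : ∀ m → lifted m ≺₁ lifted (suc m)
      step-cover m = ≺₁-resp-≈ Eq.refl (regroup m)
        (cover-transfer semimodular (ray-cover ray m) (x≤x∨y _ _) (next-not-below m))

      step-straight : ∀ m → ¬ lifted (suc (suc m)) ≤ lifted m ⁺
      step-straight m above = ray-straight ray m (begin
        g (suc (suc m))           ≤⟨ ∧-greatest (trans (x≤x∨y _ _) above)
                                                (≺₁⇒≤⁺ (ray-cover ray (suc m))) ⟩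
        lifted m ⁺ ∧ g (suc m) ⁺  ≤⟨ ⁺-∧ ⟩
        (lifted m ∧ g (suc m)) ⁺  ≈⟨ ⁺-cong (meets m) ⟩
        g m ⁺                     ∎)

    cover-join-ray : Σ Seq λ G → IsRay G × IsJoinRay g d G
    cover-join-ray with g 1 ≤? d
    ... | yes g1≤d = shift g , ray-shift ray , climbing-join g1≤d
    ... | no  g1≰d = lifted , lifted-ray g1≰d , lifting-join g1≰d

  -- If g climbs to d and k does not, (g) ∨ d ≠ (k) ∨ d: their agreement
  -- would put g 2 below (g 0)⁺.
  one-sided-climb : IsRay g → IsRay k → g 0 ≈ x → k 0 ≈ x → x ≺₁ d →
                    IsJoinRay g d G → IsJoinRay k d G → g 1 ≤ d → ¬ k 1 ≤ d → ⊥
  one-sided-climb {g} {k} {x} {d} {G} rg rk g0≈x k0≈x x≺d Jg Jk g1≤d k1≰d =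
    ray-straight rg 0 (begin
      g 2      ≈⟨ Eq.sym (join-ray-unique (ray-ascending rg) Jg (Cg.climbing-join g1≤d) 1) ⟩
      G 1      ≈⟨ join-ray-unique (ray-ascending rk) Jk (Ck.lifting-join k1≰d) 1 ⟩
      k 1 ∨ d  ≤⟨ ∨-least (trans (≺₁⇒≤⁺ (ray-cover rk 0)) (⁺-mono k0≤g0)) Cg.d≤g0⁺ ⟩
      g 0 ⁺    ∎)
    where
    module Cg = CoverStep rg g0≈x x≺d
    module Ck = CoverStep rk k0≈x x≺d
    k0≤g0 : k 0 ≤ g 0
    k0≤g0 = trans (reflexive k0≈x) (≈⇒≥ g0≈x)

  -- Two x-rays whose pointwise joins with a cover d of x agree have the
  -- same second term; otherwise g 2 ≤ (g 1 ∧ k 1)⁺ ≤ (g 0)⁺.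
  lifted-second-terms : IsRay g → IsRay k → g 0 ≈ x → k 0 ≈ x → x ≺₁ d →
                        (∀ m → g m ∨ d ≈ k m ∨ d) → g 1 ≈ k 1
  lifted-second-terms {g} {k} {x} {d} rg rk g0≈x k0≈x x≺d same with g 1 ≤? k 1
  ... | yes g1≤k1 = cover-squeeze (ray-cover rk 0) (trans (reflexive k0≈x) (Cg.x≤g 1)) g1≤k1
                      (λ g1≤k0 → ≺₁⇒≱ (ray-cover rg 0) (trans g1≤k0 k0≤g0))
    where
    module Cg = CoverStep rg g0≈x x≺d
    k0≤g0 : k 0 ≤ g 0
    k0≤g0 = trans (reflexive k0≈x) (≈⇒≥ g0≈x)
  ... | no g1≰k1 = ⊥-elim (ray-straight rg 0 (begin
        g 2            ≤⟨ ∧-greatest (≺₁⇒≤⁺ (ray-cover rg 1)) g2≤k1⁺ ⟩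
        g 1 ⁺ ∧ k 1 ⁺  ≤⟨ ⁺-∧ ⟩
        (g 1 ∧ k 1) ⁺  ≤⟨ ⁺-mono meet≤g0 ⟩
        g 0 ⁺          ∎))
    where
    module Ck = CoverStep rk k0≈x x≺d

    meet≤g0 : g 1 ∧ k 1 ≤ g 0
    meet≤g0 with cover-dichotomy (ray-cover rg 0)
                   (∧-greatest (≺₁⇒≤ (ray-cover rg 0)) (trans (reflexive g0≈x) (Ck.x≤g 1)))
                   (x∧y≤x _ _)
    ... | inj₁ meet≤g0′ = meet≤g0′
    ... | inj₂ g1≤meet  = ⊥-elim (g1≰k1 (trans g1≤meet (x∧y≤y _ _)))

    g2≤k1⁺ : g 2 ≤ k 1 ⁺
    g2≤k1⁺ = begin
      g 2      ≤⟨ x≤x∨y _ _ ⟩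
      g 2 ∨ d  ≈⟨ same 2 ⟩
      k 2 ∨ d  ≤⟨ ∨-least (≺₁⇒≤⁺ (ray-cover rk 1)) (trans (≺₁⇒≤⁺ x≺d) (⁺-mono (Ck.x≤g 1))) ⟩
      k 1 ⁺    ∎

  second-terms-agree : IsRay g → IsRay k → g 0 ≈ x → k 0 ≈ x → x ≺₁ d →
                       IsJoinRay g d G → IsJoinRay k d G → g 1 ≈ k 1
  second-terms-agree {g} {k} {x} {d} rg rk g0≈x k0≈x x≺d Jg Jk with g 1 ≤? d | k 1 ≤? d
  ... | yes g1≤d | yes k1≤d =
    Eq.trans (CoverStep.climbs rg g0≈x x≺d g1≤d) (Eq.sym (CoverStep.climbs rk k0≈x x≺d k1≤d))
  ... | yes g1≤d | no  k1≰d = ⊥-elim (one-sided-climb rg rk g0≈x k0≈x x≺d Jg Jk g1≤d k1≰d)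
  ... | no  g1≰d | yes k1≤d = ⊥-elim (one-sided-climb rk rg k0≈x g0≈x x≺d Jk Jg k1≤d g1≰d)
  ... | no  g1≰d | no  k1≰d = lifted-second-terms rg rk g0≈x k0≈x x≺d λ m → Eq.trans
    (Eq.sym (join-ray-unique (ray-ascending rg) Jg (CoverStep.lifting-join rg g0≈x x≺d g1≰d) m))
    (join-ray-unique (ray-ascending rk) Jk (CoverStep.lifting-join rk k0≈x x≺d k1≰d) m)

  shifted-join : IsRay g → g 0 ≈ x → x ≺₁ d → ¬ g 1 ≤ d → IsJoinRay g d G → y ≈ g 1 →
                 IsJoinRay (shift g) (y ∨ d) (shift G)
  shifted-join {g} {x} {d} {G} {y} rg g0≈x x≺d g1≰d J y≈g1 =
    0 , (trans (≈⇒≥ y≈g1) (x≤x∨y _ _) , g2≰y∨d) ,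
    λ m → Eq.trans (G≈lifted (suc m)) (∨-absorb (trans (reflexive y≈g1) (ray-base (ray-shift rg) m)))
    where
    open CoverStep rg g0≈x x≺d using (d≤g0⁺; lifting-join)

    G≈lifted : ∀ m → G m ≈ g m ∨ d
    G≈lifted = join-ray-unique (ray-ascending rg) J (lifting-join g1≰d)

    g2≰y∨d : ¬ g 2 ≤ y ∨ d
    g2≰y∨d g2≤ = ray-straight rg 0
      (trans g2≤ (∨-least (trans (reflexive y≈g1) (≺₁⇒≤⁺ (ray-cover rg 0))) d≤g0⁺))

  -- x-rays with a common join with a cover d of x coincide: the second
  -- terms agree, and after dropping the first terms g 1 ≺₁ g 1 ∨ d is again
  -- a cover with a common join
  cover-join-injective : ∀ n → IsRay g → IsRay k → g 0 ≈ x → k 0 ≈ x → x ≺₁ d →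
                         IsJoinRay g d G → IsJoinRay k d G → g n ≈ k n
  cover-join-injective zero _ _ g0≈x k0≈x _ _ _ = Eq.trans g0≈x (Eq.sym k0≈x)
  cover-join-injective {g} {k} {x} {d} {G} (suc n) rg rk g0≈x k0≈x x≺d Jg Jk
    with second-terms-agree rg rk g0≈x k0≈x x≺d Jg Jk | g 1 ≤? d
  ... | g1≈k1 | yes g1≤d = Eq.trans
    (Eq.sym (join-ray-unique (ray-ascending rg) Jg (CoverStep.climbing-join rg g0≈x x≺d g1≤d) n))
    (join-ray-unique (ray-ascending rk) Jk
       (CoverStep.climbing-join rk k0≈x x≺d (trans (≈⇒≥ g1≈k1) g1≤d)) n)
  ... | g1≈k1 | no g1≰d = cover-join-injective n (ray-shift rg) (ray-shift rk) Eq.refl (Eq.sym g1≈k1)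
    (cover-transfer semimodular x≺d (CoverStep.x≤g rg g0≈x x≺d 1)
                    (CoverStep.never-above rg g0≈x x≺d g1≰d 1))
    (shifted-join rg g0≈x x≺d g1≰d Jg Eq.refl)
    (shifted-join rk k0≈x x≺d (g1≰d ∘ trans (reflexive g1≈k1)) Jk g1≈k1)

  -- Joining an x-ray with any z ≥ x yields a z-ray (upward induction from
  -- x to z, one cover at a time).
  join-is-ray : x ≤ z → IsRay g → g 0 ≈ x → IsJoinRay g z H → IsRay H
  join-is-ray {z = z} x≤z = up-induction z JoinsAreRays step x≤z
    where
    JoinsAreRays : Carrier → Set (c ⊔ ℓ₁ ⊔ ℓ₂)
    JoinsAreRays x = ∀ {g H} → IsRay g → g 0 ≈ x → IsJoinRay g z H → IsRay H

    step : ∀ {x} → x ≤ z → (∀ {d} → x < d → d ≤ z → JoinsAreRays d) → JoinsAreRays x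
    step {x} x≤z above rg g0≈x J with z ≤? x
    ... | yes z≤x = ray-resp rg
      (join-ray-unique (ray-ascending rg) (join-ray-self rg (Eq.trans g0≈x (antisym x≤z z≤x))) J)
    ... | no z≰x with cover-below (x≤z , z≰x ∘ ≈⇒≥)
    ...   | d , x≺d , d≤z with CoverStep.cover-join-ray rg g0≈x x≺d
    ...     | G , rG , JG =
      above (proj₁ x≺d) d≤z rG (join-ray-base JG) (join-ray-assoc (ray-ascending rg) JG d≤z J)

  join-injective : x ≤ z → IsRay g → IsRay k → g 0 ≈ x → k 0 ≈ x →
                   IsJoinRay g z H → IsJoinRay k z H → g ≋ k
  join-injective {z = z} x≤z = up-induction z JoiningInjective step x≤z
    where
    JoiningInjective : Carrier → Set (c ⊔ ℓ₁ ⊔ ℓ₂)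
    JoiningInjective x = ∀ {g k H} → IsRay g → IsRay k → g 0 ≈ x → k 0 ≈ x →
                         IsJoinRay g z H → IsJoinRay k z H → g ≋ k

    step : ∀ {x} → x ≤ z → (∀ {d} → x < d → d ≤ z → JoiningInjective d) → JoiningInjective x
    step {x} x≤z above rg rk g0≈x k0≈x Jg Jk with z ≤? x
    ... | yes z≤x = λ m → Eq.trans
      (Eq.sym (join-ray-unique (ray-ascending rg) Jg (join-ray-self rg (Eq.trans g0≈x x≈z)) m))
      (join-ray-unique (ray-ascending rk) Jk (join-ray-self rk (Eq.trans k0≈x x≈z)) m)
      where
      x≈z : x ≈ z
      x≈z = antisym x≤z z≤x
    ... | no z≰x with cover-below (x≤z , z≰x ∘ ≈⇒≥)
    ...   | d , x≺d , d≤z with CoverStep.cover-join-ray rg g0≈x x≺d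
                             | CoverStep.cover-join-ray rk k0≈x x≺d
    ...     | G , rG , JG | K , rK , JK =
      λ n → cover-join-injective n rg rk g0≈x k0≈x x≺d JG (join-ray-resp JK (λ m → Eq.sym (G≋K m)))
      where
      G≋K : G ≋ K
      G≋K = above (proj₁ x≺d) d≤z rG rK (join-ray-base JG) (join-ray-base JK)
              (join-ray-assoc (ray-ascending rg) JG d≤z Jg)
              (join-ray-assoc (ray-ascending rk) JK d≤z Jk)

  CommonJoin : Seq → Seq → Carrier → Set (c ⊔ ℓ₁ ⊔ ℓ₂)
  CommonJoin e h u = ∃ λ W → IsJoinRay e u W × IsJoinRay h u W

  common-join-trans : Ascending f → CommonJoin e f u → CommonJoin f h u → CommonJoin e h u
  common-join-trans asc (W , eW , fW) (W′ , fW′ , hW′) =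
    W , eW , join-ray-resp hW′ (λ m → Eq.sym (join-ray-unique asc fW fW′ m))

  -- a common join persists to every larger element, by associativity
  common-join-up : IsRay e → IsRay h → u ≤ v → CommonJoin e h u → CommonJoin e h v
  common-join-up re rh u≤v (W , eW , hW)
    with join-ray-exists re (trans (join-ray-base≤ (ray-ascending re) eW) u≤v)
       | join-ray-exists rh (trans (join-ray-base≤ (ray-ascending rh) hW) u≤v)
  ... | We , eWe | Wh , hWh = We , eWe , join-ray-resp hWh
    (join-ray-unique (join-ray-ascending (ray-ascending rh) hW)
      (join-ray-assoc (ray-ascending rh) hW u≤v hWh)
      (join-ray-assoc (ray-ascending re) eW u≤v eWe))

  -- a common join descends to every z ≤ u above both bases, by injectivity
  common-join-down : IsRay e → IsRay h → e 0 ≤ z → h 0 ≤ z → z ≤ u →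
                     CommonJoin e h u → CommonJoin e h z
  common-join-down re rh e0≤z h0≤z z≤u (W , eW , hW)
    with join-ray-exists re e0≤z | join-ray-exists rh h0≤z
  ... | G , eG | H , hH = G , eG , join-ray-resp hH (λ m → Eq.sym (G≋H m))
    where
    G≋H : G ≋ H
    G≋H = join-injective z≤u (join-is-ray e0≤z re Eq.refl eG) (join-is-ray h0≤z rh Eq.refl hH)
            (join-ray-base eG) (join-ray-base hH)
            (join-ray-assoc (ray-ascending re) eG z≤u eW)
            (join-ray-assoc (ray-ascending rh) hH z≤u hW)

  ∥-refl : ∀ {e} → e ∥ e
  ∥-refl {e , re} = e , self , self
    where
    self : IsJoinRay e (e 0 ∨ e 0) e
    self = join-ray-self re (Eq.sym (∨-idempotent (e 0)))

  ∥-sym : ∀ {e f} → e ∥ f → f ∥ e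
  ∥-sym (W , eW , fW) = W , join-ray-resp-base fW (∨-comm _ _) , join-ray-resp-base eW (∨-comm _ _)

  -- e ∥ f and f ∥ h give a common join of e and h at
  -- u = (e 0 ∨ f 0) ∨ (f 0 ∨ h 0), which descends to e 0 ∨ h 0
  ∥-trans : ∀ {e f h} → e ∥ f → f ∥ h → e ∥ h
  ∥-trans {e , re} {f , rf} {h , rh} e∥f f∥h =
    common-join-down re rh (x≤x∨y _ _) (y≤x∨y _ _) eh≤u
      (common-join-trans (ray-ascending rf)
        (common-join-up re rf (x≤x∨y _ _) e∥f)
        (common-join-up rf rh (y≤x∨y _ _) f∥h))
    where
    eh≤u : e 0 ∨ h 0 ≤ (e 0 ∨ f 0) ∨ (f 0 ∨ h 0)
    eh≤u = ∨-monotonic (x≤x∨y _ _) (y≤x∨y _ _)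

lemma4p9 : ∀ {c ℓ₁ ℓ₂} → ExcludedMiddle (c ⊔ ℓ₁ ⊔ ℓ₂) →
    (L : Lattice c ℓ₁ ℓ₂) (U : LatticeNotions.IsUniformSemimodular L) →
    IsEquivalence (RayNotions._∥_ L U)
lemma4p9 em L U = record
  { refl  = λ {e} → ∥-refl {e}
  ; sym   = λ {e f} → ∥-sym {e} {f}
  ; trans = λ {e f h} → ∥-trans {e} {f} {h}
  }
  where open Rays em L U
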